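{- For all positive integers $k$ and $r$, $g_3(k,r)=r\binom{k}{\lfloor k/2\rfloor}$.
   Context: Model 3 (non-adaptive, $r+2$ players $A,B,C_1,\dots,C_r$, $r\ge 1$). Player $A$ chooses an unknown defective element $d$ of a finite set $X$. A query is an ordered $r$-tuple $(X_1,\dots,X_r)$ of pairwise disjoint subsets of $X$ (their union need not be $X$); Player $B$ chooses all $k$ queries at once. For each query, if $d\in X_i$ then Player $C_i$ is given the set $X_i$ (a YES answer together with the set); the players $C_i$ have no other information about the queries. Player $C_i$ can identify $d$ iff $d$ is the unique element of $X$ contained in every set given to $C_i$ (if $C_i$ is given no sets, this means $X=\{d\}$). A collection of queries solves Model 3 if for every choice of $d\in X$ at least one player $C_i$ can identify $d$. $g_3(k,r)$ denotes the largest $n$ such that on an $n$-element set there are $k$ queries solving Model 3. -}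

module Defs where

open import Data.Nat using (ℕ; _≤_)
open import Data.Fin using (Fin)
open import Data.Fin.Subset using (Subset; _∈_; _∉_)
open import Data.Product using (Σ; _×_)
open import Relation.Binary.PropositionalEquality using (_≡_; _≢_)

-- A query on X = Fin n for players C_1..C_r: an r-tuple of subsets of X
-- (pairwise disjoint, imposed separately; union need not be X).
Query : ℕ → ℕ → Set
Query r n = Fin r → Subset n

PairwiseDisjoint : ∀ {r n} → Query r n → Set
PairwiseDisjoint {r} {n} Q =
  ∀ (i j : Fin r) → i ≢ j → ∀ (x : Fin n) → x ∈ Q i → x ∉ Q j

Queries : ℕ → ℕ → ℕ → Set
Queries k r n = Fin k → Query r n

-- Player C_i can identify d: d is the unique element of X contained in
-- every set given to C_i, i.e. in every Q q i with d ∈ Q q i.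
-- (If no set is given to C_i this says X = {d}.)
Identifies : ∀ {k r n} → Queries k r n → Fin r → Fin n → Set
Identifies {k} {r} {n} Qs i d =
  ∀ (y : Fin n) → (∀ (q : Fin k) → d ∈ Qs q i → y ∈ Qs q i) → y ≡ d

Solves : ∀ {k r n} → Queries k r n → Set
Solves {k} {r} {n} Qs =
  (∀ (q : Fin k) → PairwiseDisjoint (Qs q)) ×
  (∀ (d : Fin n) → Σ (Fin r) (λ i → Identifies Qs i d))

Solvable : ℕ → ℕ → ℕ → Set
Solvable k r n = Σ (Queries k r n) Solves

IsG3 : ℕ → ℕ → ℕ → Set
IsG3 k r m = Solvable k r m × (∀ (n : ℕ) → Solvable k r n → n ≤ m)

{-# OPTIONS --safe #-}

-- Assign each element d to a player Cᵢ that identifies it, and let S(d) be the set of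
-- queries whose i-th part contains d.  That Cᵢ identifies d says that S(d) ⊆ S(y) forces
-- y = d, so the S(d) of the elements assigned to Cᵢ form an antichain of subsets of the
-- k queries, and Sperner's theorem bounds their number by C(k, ⌊k/2⌋).  Conversely, take
-- as elements the pairs (i, t) with t a ⌊k/2⌋-subset of the queries, and put (i, t) into
-- the i-th part of every query outside t: as ⌊k/2⌋ < k, Cᵢ receives some set, and the
-- sets it receives determine t among the sets of that size.  Sperner's theorem follows
-- from the LYM inequality Σ |A|! (m − |A|)! ≤ m!, proved by induction on m.

module Submission where

open import Defs
open import Data.Bool using (Bool; true; false; T; _∧_)
open import Data.Bool.Properties using (T-≡; T-∧)
open import Data.Empty using (⊥-elim)
open import Data.Fin using (Fin; zero; suc; splitAt; join; remQuot; combine; _≟_)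
open import Data.Fin.Properties using (any?; join-splitAt; combine-remQuot)
open import Data.Fin.Subset
  using (Subset; inside; outside; _∈_; _∉_; _⊆_; _-_; _∩_; ∁; ∣_∣; ⊥; ⊤)
open import Data.Fin.Subset.Properties
  using (∣p∣≤n; ∣⊤∣≡n; ∣⊥∣≡0; ⊆⊤; p⊆q⇒∣p∣≤∣q∣; drop-there; drop-∷-⊆; p─⊥≡p; p─q⊆p;
         x∈p∧x≢y⇒x∈p-y; x∈p∩q⁺; x∈p∩q⁻; x∈∁p⇒x∉p; x∉p⇒x∈∁p; ∁p⊆∁q⇒p⊇q)
open import Data.Nat
  using (ℕ; zero; suc; pred; _+_; _*_; _∸_; _≤_; _<_; _!; z≤n; s≤s; s≤s⁻¹; s<s⁻¹; >-nonZero)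
open import Data.Nat.Properties hiding (_≟_)
open import Data.Nat.Properties using () renaming (_≟_ to _≟ℕ_)
open import Data.Nat.DivMod using (_/_; _%_; m≡m%n+[m/n]*n; m%n<n; m/n*n≤m; m/n*n≡m; m/n≤m; m/n<m)
open import Data.Nat.Combinatorics
  using (_C_; nCk+nC[k+1]≡[n+1]C[k+1]; [n-k]*d[k+1]≡[k+1]*d[k]; k![n∸k]!∣n!)
open import Data.Nat.Combinatorics.Specification using (nCk≡n!/k![n-k]!)
open import Data.Product using (∃; _×_; _,_; proj₁; proj₂; uncurry)
open import Data.Sum using (inj₁; inj₂; [_,_]′)
open import Data.Vec using ([]; _∷_; lookup; tabulate; here; there)
open import Data.Vec.Properties using (∷-injectiveʳ; []=⇒lookup; lookup⇒[]=; lookup∘tabulate)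
open import Function using (_∘_; Equivalence)
open import Relation.Binary.PropositionalEquality
open import Relation.Binary.PropositionalEquality.Properties using (subst-injective)
open import Relation.Nullary using (¬_; yes; no; contradiction; ⌊_⌋)
open import Relation.Nullary.Decidable using (T?; _×-dec_; fromWitness; toWitness; ⌊⌋-map′)
open import Algebra.Properties.CommutativeSemigroup *-commutativeSemigroup using (x∙yz≈y∙xz)
open import Algebra.Properties.Semiring.Sum +-*-semiring
  using (sum; sum-syntax; sum-replicate-zero; ∑-comm; *-distribʳ-sum; sum-cong-≗)

open ≤-Reasoning

χ : Bool → ℕ
χ true  = 1
χ false = 0

χ-mono : ∀ {b c} → (T b → T c) → χ b ≤ χ c
χ-mono {false}         _ = z≤n
χ-mono {true}  {true}  _ = ≤-refl
χ-mono {true}  {false} h = ⊥-elim (h _)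

χ-guard : ∀ b {x y} → (T b → x ≡ y) → χ b * x ≡ χ b * y
χ-guard true  h = cong (1 *_) (h _)
χ-guard false _ = refl

χ-*-≡0 : ∀ b {x} → ¬ T b → χ b * x ≡ 0
χ-*-≡0 true  h = ⊥-elim (h _)
χ-*-≡0 false _ = refl

χ-∧-* : ∀ b c x → χ c * (χ b * x) ≡ χ (b ∧ c) * x
χ-∧-* true  c x = cong (χ c *_) (*-identityˡ x)
χ-∧-* false c x = *-zeroʳ (χ c)

∑-mono-≤ : ∀ {n} {f g : Fin n → ℕ} → (∀ i → f i ≤ g i) → sum f ≤ sum g
∑-mono-≤ {zero}  f≤g = z≤n
∑-mono-≤ {suc n} f≤g = +-mono-≤ (f≤g zero) (∑-mono-≤ (f≤g ∘ suc))

∑-zero : ∀ {n} {f : Fin n → ℕ} → (∀ i → f i ≡ 0) → sum f ≡ 0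
∑-zero {zero}  f≡0 = refl
∑-zero {suc n} f≡0 = cong₂ _+_ (f≡0 zero) (∑-zero (f≡0 ∘ suc))

∑-const : ∀ n c → ∑[ i < n ] c ≡ n * c
∑-const zero    c = refl
∑-const (suc n) c = cong (c +_) (∑-const n c)

∑-δ : ∀ {n} (a : Fin n) (g : Fin n → ℕ) → ∑[ b < n ] (χ ⌊ b ≟ a ⌋ * g b) ≡ g a
∑-δ {suc n} zero g = trans (cong₂ _+_ (*-identityˡ (g zero)) (sum-replicate-zero n)) (+-identityʳ _)
∑-δ {suc n} (suc a) g =
  trans (sum-cong-≗ (λ b → cong (λ x → χ x * g (suc b)) (⌊⌋-map′ _ _ (b ≟ a)))) (∑-δ a (g ∘ suc))

∑-χ-unique : ∀ {n} (D : Fin n → Bool) (g : Fin n → ℕ) {a} → (∀ {b} → T (D b) → b ≡ a) →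
             ∑[ b < n ] (χ (D b) * g b) ≤ g a
∑-χ-unique {n} D g {a} unique = begin
  ∑[ b < n ] (χ (D b) * g b)      ≤⟨ ∑-mono-≤ (λ b → *-monoˡ-≤ (g b) (χ-mono (selected⇒≡ b))) ⟩
  ∑[ b < n ] (χ ⌊ b ≟ a ⌋ * g b)  ≡⟨ ∑-δ a g ⟩
  g a                             ∎
  where
  selected⇒≡ : ∀ b → T (D b) → T ⌊ b ≟ a ⌋
  selected⇒≡ b Db = fromWitness (unique Db)

∑-fibres : ∀ {n r} (φ : Fin n → Fin r) → ∑[ i < r ] ∑[ a < n ] χ ⌊ i ≟ φ a ⌋ ≡ n
∑-fibres {n} {r} φ = begin-equality
  ∑[ i < r ] ∑[ a < n ] χ ⌊ i ≟ φ a ⌋  ≡⟨ ∑-comm (λ i a → χ ⌊ i ≟ φ a ⌋) ⟩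
  ∑[ a < n ] ∑[ i < r ] χ ⌊ i ≟ φ a ⌋  ≡⟨ sum-cong-≗ fibre ⟩
  ∑[ a < n ] 1                         ≡⟨ trans (∑-const n 1) (*-identityʳ n) ⟩
  n                                    ∎
  where
  fibre : ∀ a → ∑[ i < r ] χ ⌊ i ≟ φ a ⌋ ≡ 1
  fibre a = trans (sum-cong-≗ (λ i → sym (*-identityʳ (χ ⌊ i ≟ φ a ⌋)))) (∑-δ (φ a) (λ _ → 1))

∈⇒T-lookup : ∀ {n} {p : Subset n} {x} → x ∈ p → T (lookup p x)
∈⇒T-lookup x∈p = Equivalence.from T-≡ ([]=⇒lookup x∈p)

T-lookup⇒∈ : ∀ {n} {p : Subset n} {x} → T (lookup p x) → x ∈ p
T-lookup⇒∈ {p = p} {x} t = lookup⇒[]= x p (Equivalence.to T-≡ t)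

∈-tabulate⁺ : ∀ {n} {f : Fin n → Bool} {x} → T (f x) → x ∈ tabulate f
∈-tabulate⁺ {f = f} {x} t = T-lookup⇒∈ (subst T (sym (lookup∘tabulate f x)) t)

∈-tabulate⁻ : ∀ {n} {f : Fin n → Bool} {x} → x ∈ tabulate f → T (f x)
∈-tabulate⁻ {f = f} {x} x∈ = subst T (lookup∘tabulate f x) (∈⇒T-lookup x∈)

∣p∣≡∑χ : ∀ {n} (p : Subset n) → ∣ p ∣ ≡ ∑[ x < n ] χ (lookup p x)
∣p∣≡∑χ []            = refl
∣p∣≡∑χ (inside  ∷ p) = cong suc (∣p∣≡∑χ p)
∣p∣≡∑χ (outside ∷ p) = ∣p∣≡∑χ p

∣p∣≡1+∣p-x∣ : ∀ {n} {p : Subset n} {x} → x ∈ p → ∣ p ∣ ≡ suc ∣ p - x ∣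
∣p∣≡1+∣p-x∣ {p = inside  ∷ p} here        = cong (suc ∘ ∣_∣) (sym (p─⊥≡p p))
∣p∣≡1+∣p-x∣ {p = inside  ∷ p} (there x∈p) = cong suc (∣p∣≡1+∣p-x∣ x∈p)
∣p∣≡1+∣p-x∣ {p = outside ∷ p} (there x∈p) = ∣p∣≡1+∣p-x∣ x∈p

x∉p-x : ∀ {n} (p : Subset n) x → x ∉ p - x
x∉p-x (_ ∷ _) zero    ()
x∉p-x (_ ∷ p) (suc x) (there x∈p-x) = x∉p-x p x x∈p-x

p⊆q⇒p-x⊆q-x : ∀ {n} {p q : Subset n} {x} → p ⊆ q → p - x ⊆ q - x
p⊆q⇒p-x⊆q-x {p = p} {x = x} p⊆q y∈p-x =
  x∈p∧x≢y⇒x∈p-y (p⊆q (p─q⊆p p _ y∈p-x)) (λ { refl → x∉p-x p x y∈p-x })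

p⊆q∧∣p∣≡∣q∣⇒p≡q : ∀ {n} {p q : Subset n} → p ⊆ q → ∣ p ∣ ≡ ∣ q ∣ → p ≡ q
p⊆q∧∣p∣≡∣q∣⇒p≡q {p = []}          {[]}          _ _ = refl
p⊆q∧∣p∣≡∣q∣⇒p≡q {p = inside  ∷ p} {inside  ∷ q} p⊆q e =
  cong (inside ∷_) (p⊆q∧∣p∣≡∣q∣⇒p≡q (drop-∷-⊆ p⊆q) (suc-injective e))
p⊆q∧∣p∣≡∣q∣⇒p≡q {p = outside ∷ p} {outside ∷ q} p⊆q e =
  cong (outside ∷_) (p⊆q∧∣p∣≡∣q∣⇒p≡q (drop-∷-⊆ p⊆q) e)
p⊆q∧∣p∣≡∣q∣⇒p≡q {p = inside  ∷ p} {outside ∷ q} p⊆q _ = contradiction (p⊆q here) λ ()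
p⊆q∧∣p∣≡∣q∣⇒p≡q {p = outside ∷ p} {inside  ∷ q} p⊆q e =
  contradiction e (<⇒≢ (s≤s (p⊆q⇒∣p∣≤∣q∣ (drop-∷-⊆ p⊆q))))

∣p∣<n⇒∃∉ : ∀ {n} (p : Subset n) → ∣ p ∣ < n → ∃ λ x → x ∉ p
∣p∣<n⇒∃∉ (outside ∷ p) _ = zero , λ ()
∣p∣<n⇒∃∉ (inside  ∷ p) ∣p∣<n =
  let x , x∉p = ∣p∣<n⇒∃∉ p (s<s⁻¹ ∣p∣<n) in suc x , x∉p ∘ drop-there

double-count : ∀ {N n} (f : Fin N → Subset n) (g : Fin N → ℕ) →
               ∑[ a < N ] (∣ f a ∣ * g a) ≡ ∑[ x < n ] ∑[ a < N ] (χ (lookup (f a) x) * g a)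
double-count {N} {n} f g = begin-equality
  ∑[ a < N ] (∣ f a ∣ * g a)
    ≡⟨ sum-cong-≗ (λ a → cong (_* g a) (∣p∣≡∑χ (f a))) ⟩
  ∑[ a < N ] ((∑[ x < n ] χ (lookup (f a) x)) * g a)
    ≡⟨ sum-cong-≗ (λ a → *-distribʳ-sum (g a) (λ x → χ (lookup (f a) x))) ⟩
  ∑[ a < N ] ∑[ x < n ] (χ (lookup (f a) x) * g a)
    ≡⟨ ∑-comm (λ a x → χ (lookup (f a) x) * g a) ⟩
  ∑[ x < n ] ∑[ a < N ] (χ (lookup (f a) x) * g a) ∎

-- An s-subset of an m-set lies on s! (m ∸ s)! of the m! maximal chains.
chainsThrough : ℕ → ℕ → ℕ
chainsThrough m s = s ! * (m ∸ s) !

chainsThrough-pred : ∀ m {s} → s ≢ 0 → chainsThrough (suc m) s ≡ s * chainsThrough m (pred s)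
chainsThrough-pred m {zero}  s≢0 = contradiction refl s≢0
chainsThrough-pred m {suc s} _   = *-assoc (suc s) (s !) ((m ∸ s) !)

-- The family of the f a with T (D a); the condition also rules out repeated members.
Antichain : ∀ {N n} → (Fin N → Bool) → (Fin N → Subset n) → Set
Antichain D f = ∀ {a b} → T (D a) → T (D b) → f a ⊆ f b → a ≡ b

antichain-remove : ∀ {N n} {D : Fin N → Bool} {f : Fin N → Subset n} x → Antichain D f →
                   Antichain (λ a → D a ∧ lookup (f a) x) (λ a → f a - x)
antichain-remove {D = D} {f} x anti {a} {b} Da′ Db′ fa-x⊆fb-x =
  anti (proj₁ (Equivalence.to T-∧ Da′)) Db (λ {y} y∈fa → lift y y∈fa)
  where
  Db : T (D b)
  Db = proj₁ (Equivalence.to T-∧ Db′)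
  lift : ∀ y → y ∈ f a → y ∈ f b
  lift y y∈fa with y ≟ x
  ... | yes refl = T-lookup⇒∈ (proj₂ (Equivalence.to (T-∧ {D b}) Db′))
  ... | no  y≢x  = p─q⊆p (f b) _ (fa-x⊆fb-x (x∈p∧x≢y⇒x∈p-y y∈fa y≢x))

lym-∅-member : ∀ {N n} m (D : Fin N → Bool) (f : Fin N → Subset n) → Antichain D f →
               ∀ {a} → T (D a) → ∣ f a ∣ ≡ 0 → ∑[ b < N ] (χ (D b) * chainsThrough m ∣ f b ∣) ≤ m !
lym-∅-member {N} m D f anti {a} Da ∣fa∣≡0 = begin
  ∑[ b < N ] (χ (D b) * chainsThrough m ∣ f b ∣)  ≤⟨ ∑-χ-unique D _ (λ Db → sym (anti Da Db fa⊆)) ⟩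
  chainsThrough m ∣ f a ∣                         ≡⟨ cong (chainsThrough m) ∣fa∣≡0 ⟩
  1 * m !                                         ≡⟨ *-identityˡ (m !) ⟩
  m !                                             ∎
  where
  fa⊆ : ∀ {p} → f a ⊆ p
  fa⊆ y∈fa = contradiction (trans (sym ∣fa∣≡0) (∣p∣≡1+∣p-x∣ y∈fa)) 0≢1+n

-- If ∅ is a member it is the only one.  Otherwise count the pairs (a, x) with x ∈ f a:
-- for fixed x, the members through x, with x deleted, form an antichain in U - x.
lym : ∀ {N n} m (U : Subset n) → ∣ U ∣ ≡ m → (D : Fin N → Bool) (f : Fin N → Subset n) →
      (∀ {a} → T (D a) → f a ⊆ U) → Antichain D f →
      ∑[ a < N ] (χ (D a) * chainsThrough m ∣ f a ∣) ≤ m !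
lym m U ∣U∣≡m D f f⊆U anti with any? (λ a → T? (D a) ×-dec (∣ f a ∣ ≟ℕ 0))
... | yes (a , Da , ∣fa∣≡0) = lym-∅-member m D f anti Da ∣fa∣≡0
lym zero _ ∣U∣≡0 D f f⊆U _ | no ∄ =
  ≤-trans (≤-reflexive (∑-zero (λ a → χ-*-≡0 (D a) (λ Da → ∄ (a , Da , empty Da))))) z≤n
  where
  empty : ∀ {a} → T (D a) → ∣ f a ∣ ≡ 0
  empty Da = n≤0⇒n≡0 (≤-trans (p⊆q⇒∣p∣≤∣q∣ (f⊆U Da)) (≤-reflexive ∣U∣≡0))
lym {N} {n} (suc m) U ∣U∣≡1+m D f f⊆U anti | no ∄ = begin
  ∑[ a < N ] (χ (D a) * chainsThrough (suc m) ∣ f a ∣)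
    ≡⟨ sum-cong-≗ (λ a → trans (χ-guard (D a) (λ Da → chainsThrough-pred m (λ e → ∄ (a , Da , e))))
                               (x∙yz≈y∙xz (χ (D a)) ∣ f a ∣ _)) ⟩
  ∑[ a < N ] (∣ f a ∣ * g a)
    ≡⟨ double-count f g ⟩
  ∑[ x < n ] ∑[ a < N ] (χ (lookup (f a) x) * g a)
    ≤⟨ ∑-mono-≤ through ⟩
  ∑[ x < n ] (χ (lookup U x) * m !)
    ≡⟨ *-distribʳ-sum (m !) (λ x → χ (lookup U x)) ⟨
  (∑[ x < n ] χ (lookup U x)) * m !
    ≡⟨ cong (_* m !) (trans (sym (∣p∣≡∑χ U)) ∣U∣≡1+m) ⟩
  suc m !
    ∎
  where
  g : Fin N → ℕ
  g a = χ (D a) * chainsThrough m (pred ∣ f a ∣)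

  D′ : Fin n → Fin N → Bool
  D′ x a = D a ∧ lookup (f a) x

  through : ∀ x → ∑[ a < N ] (χ (lookup (f a) x) * g a) ≤ χ (lookup U x) * m !
  through x with lookup U x in U[x]
  ... | true  = begin
    ∑[ a < N ] (χ (lookup (f a) x) * g a)
      ≡⟨ sum-cong-≗ (λ a → trans (χ-∧-* (D a) (lookup (f a) x) _) (χ-guard (D′ x a) (∣fa-x∣ a))) ⟩
    ∑[ a < N ] (χ (D′ x a) * chainsThrough m ∣ f a - x ∣)
      ≤⟨ lym m (U - x) ∣U-x∣≡m (D′ x) (λ a → f a - x)
             (λ D′a → p⊆q⇒p-x⊆q-x (f⊆U (proj₁ (Equivalence.to T-∧ D′a))))
             (antichain-remove x anti) ⟩
    m !
      ≡⟨ *-identityˡ (m !) ⟨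
    1 * m ! ∎
    where
    ∣U-x∣≡m : ∣ U - x ∣ ≡ m
    ∣U-x∣≡m = suc-injective (trans (sym (∣p∣≡1+∣p-x∣ (lookup⇒[]= x U U[x]))) ∣U∣≡1+m)
    ∣fa-x∣ : ∀ a → T (D′ x a) → chainsThrough m (pred ∣ f a ∣) ≡ chainsThrough m ∣ f a - x ∣
    ∣fa-x∣ a D′a = cong (chainsThrough m ∘ pred)
      (∣p∣≡1+∣p-x∣ {p = f a} (T-lookup⇒∈ (proj₂ (Equivalence.to (T-∧ {D a}) D′a))))
  ... | false = ≤-reflexive (∑-zero (λ a → trans (χ-∧-* (D a) (lookup (f a) x) _)
                                                 (χ-*-≡0 (D′ x a) (x∉U a))))
    where
    x∉U : ∀ a → ¬ T (D′ x a)
    x∉U a D′a = let Da , x∈fa = Equivalence.to (T-∧ {D a}) D′a in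
      subst T U[x] (∈⇒T-lookup (f⊆U Da (T-lookup⇒∈ x∈fa)))

stepwise-antitone : ∀ (f : ℕ → ℕ) {c} → (∀ {s} → s < c → f (suc s) ≤ f s) →
                    ∀ {s} → s ≤ c → f c ≤ f s
stepwise-antitone f {zero}  _    z≤n = ≤-refl
stepwise-antitone f {suc c} down {s} s≤1+c with m≤n⇒m<n∨m≡n s≤1+c
... | inj₂ refl  = ≤-refl
... | inj₁ s<1+c = ≤-trans (down (n<1+n c)) (stepwise-antitone f (down ∘ m<n⇒m<1+n) (s≤s⁻¹ s<1+c))

stepwise-monotone : ∀ (f : ℕ → ℕ) {c k} → (∀ {s} → c ≤ s → s < k → f s ≤ f (suc s)) →
                    ∀ {s} → c ≤ s → s ≤ k → f c ≤ f s
stepwise-monotone f up {zero}  z≤n _ = ≤-refl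
stepwise-monotone f up {suc s} c≤1+s 1+s≤k with m≤n⇒m<n∨m≡n c≤1+s
... | inj₂ refl  = ≤-refl
... | inj₁ c<1+s = ≤-trans (stepwise-monotone f up c≤s (<⇒≤ 1+s≤k)) (up c≤s 1+s≤k)
  where
  c≤s = s≤s⁻¹ c<1+s

k/2-bounds : ∀ k → k / 2 + k / 2 ≤ k × k ≤ suc (k / 2 + k / 2)
k/2-bounds k = subst (_≤ k) double (m/n*n≤m k 2) , (begin
  k                 ≡⟨ m≡m%n+[m/n]*n k 2 ⟩
  k % 2 + k / 2 * 2 ≤⟨ +-monoˡ-≤ _ (s≤s⁻¹ (m%n<n k 2)) ⟩
  suc (k / 2 * 2)   ≡⟨ cong suc double ⟩
  suc (k / 2 + k / 2) ∎)
  where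
  double : k / 2 * 2 ≡ k / 2 + k / 2
  double = trans (*-comm (k / 2) 2) (cong (k / 2 +_) (+-identityʳ (k / 2)))

chainsThrough-falls : ∀ {k s} → suc s + s ≤ k → chainsThrough k (suc s) ≤ chainsThrough k s
chainsThrough-falls {k} {s} 2s+1≤k = *-cancelˡ-≤ (suc s) (begin
  suc s * chainsThrough k (suc s)   ≤⟨ *-monoˡ-≤ _ (m+n≤o⇒m≤o∸n (suc s) 2s+1≤k) ⟩
  (k ∸ s) * chainsThrough k (suc s) ≡⟨ [n-k]*d[k+1]≡[k+1]*d[k] (≤-trans (m≤m+n (suc s) s) 2s+1≤k) ⟩
  suc s * chainsThrough k s         ∎)

chainsThrough-rises : ∀ {k s} → s < k → k ≤ s + suc s → chainsThrough k s ≤ chainsThrough k (suc s)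
chainsThrough-rises {k} {s} s<k k≤2s+1 = *-cancelˡ-≤ (k ∸ s) {{>-nonZero (m<n⇒0<n∸m s<k)}} (begin
  (k ∸ s) * chainsThrough k s       ≤⟨ *-monoˡ-≤ _ (m≤n+o⇒m∸n≤o k s k≤2s+1) ⟩
  suc s * chainsThrough k s         ≡⟨ [n-k]*d[k+1]≡[k+1]*d[k] s<k ⟨
  (k ∸ s) * chainsThrough k (suc s) ∎)

chainsThrough-minimal : ∀ {k s} → s ≤ k → chainsThrough k (k / 2) ≤ chainsThrough k s
chainsThrough-minimal {k} {s} s≤k =
  [ stepwise-antitone (chainsThrough k) falls
  , (λ c≤s → stepwise-monotone (chainsThrough k) rises c≤s s≤k)
  ]′ (≤-total s c)
  where
  c = k / 2
  falls : ∀ {s} → s < c → chainsThrough k (suc s) ≤ chainsThrough k s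
  falls {s} s<c = chainsThrough-falls {k} {s}
    (≤-trans (+-mono-≤ s<c (<⇒≤ s<c)) (proj₁ (k/2-bounds k)))
  rises : ∀ {s} → c ≤ s → s < k → chainsThrough k s ≤ chainsThrough k (suc s)
  rises {s} c≤s s<k = chainsThrough-rises s<k
    (≤-trans (proj₂ (k/2-bounds k))
             (≤-trans (s≤s (+-mono-≤ c≤s c≤s)) (≤-reflexive (sym (+-suc s s)))))

nCk*chainsThrough≡n! : ∀ {n k} → k ≤ n → (n C k) * chainsThrough n k ≡ n !
nCk*chainsThrough≡n! {n} {k} k≤n = trans (cong (_* chainsThrough n k) (nCk≡n!/k![n-k]! k≤n))
  (m/n*n≡m {{k !* (n ∸ k) !≢0}} (k![n∸k]!∣n! k≤n))

sperner : ∀ {N k} (D : Fin N → Bool) (f : Fin N → Subset k) → Antichain D f →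
          ∑[ a < N ] χ (D a) ≤ k C (k / 2)
sperner {N} {k} D f anti = *-cancelʳ-≤ _ _ (chainsThrough k c) {{c !* (k ∸ c) !≢0}} (begin
  (∑[ a < N ] χ (D a)) * chainsThrough k c      ≡⟨ *-distribʳ-sum _ (λ a → χ (D a)) ⟩
  ∑[ a < N ] (χ (D a) * chainsThrough k c)      ≤⟨ ∑-mono-≤ (λ a → *-monoʳ-≤ (χ (D a))
                                                     (chainsThrough-minimal (∣p∣≤n (f a)))) ⟩
  ∑[ a < N ] (χ (D a) * chainsThrough k ∣ f a ∣) ≤⟨ lym k ⊤ (∣⊤∣≡n k) D f (λ _ → ⊆⊤) anti ⟩
  k !                                           ≡⟨ nCk*chainsThrough≡n! (m/n≤m k 2) ⟨
  (k C c) * chainsThrough k c                   ∎)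
  where
  c = k / 2

pascal : ∀ n k → suc n C suc k ≡ n C k + n C suc k
pascal n k = sym (nCk+nC[k+1]≡[n+1]C[k+1] n k)

splitAt-injective : ∀ m {n} {i j : Fin (m + n)} → splitAt m i ≡ splitAt m j → i ≡ j
splitAt-injective m {n} {i} {j} e =
  trans (sym (join-splitAt m n i)) (trans (cong (join m n) e) (join-splitAt m n j))

-- Pascal's rule: the first n C k of the (k+1)-subsets of Fin (suc n) are those containing 0.
layer : ∀ n k → Fin (n C k) → Subset n
layer zero    _       _ = []
layer (suc n) zero    _ = ⊥
layer (suc n) (suc k) i =
  [ (inside ∷_) ∘ layer n k , (outside ∷_) ∘ layer n (suc k) ]′
    (splitAt (n C k) (subst Fin (pascal n k) i))

∣layer∣≡k : ∀ n k (i : Fin (n C k)) → ∣ layer n k i ∣ ≡ k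
∣layer∣≡k zero    zero    _ = refl
∣layer∣≡k (suc n) zero    _ = ∣⊥∣≡0 (suc n)
∣layer∣≡k (suc n) (suc k) i with splitAt (n C k) (subst Fin (pascal n k) i)
... | inj₁ j = cong suc (∣layer∣≡k n k j)
... | inj₂ j = ∣layer∣≡k n (suc k) j

layer-injective : ∀ n k {i j : Fin (n C k)} → layer n k i ≡ layer n k j → i ≡ j
layer-injective zero    zero    {zero} {zero} _ = refl
layer-injective (suc n) zero    {zero} {zero} _ = refl
layer-injective (suc n) (suc k) {i} {j} e =
  subst-injective (pascal n k) (splitAt-injective (n C k) (branch-injective _ _ e))
  where
  branch-injective : ∀ s t → [ (inside ∷_) ∘ layer n k , (outside ∷_) ∘ layer n (suc k) ]′ s
                           ≡ [ (inside ∷_) ∘ layer n k , (outside ∷_) ∘ layer n (suc k) ]′ t → s ≡ t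
  branch-injective (inj₁ s) (inj₁ t) e = cong inj₁ (layer-injective n k (∷-injectiveʳ e))
  branch-injective (inj₂ s) (inj₂ t) e = cong inj₂ (layer-injective n (suc k) (∷-injectiveʳ e))
  branch-injective (inj₁ _) (inj₂ _) ()
  branch-injective (inj₂ _) (inj₁ _) ()

remQuot-injective : ∀ {m} n {i j : Fin (m * n)} → remQuot {m} n i ≡ remQuot n j → i ≡ j
remQuot-injective {m} n {i} {j} e =
  trans (sym (combine-remQuot {m} n i))
        (trans (cong (uncurry (combine {m})) e) (combine-remQuot {m} n j))

trace : ∀ {k r n} → Queries k r n → Fin r → Fin n → Subset k
trace Qs i a = tabulate (λ q → lookup (Qs q i) a)

identifies⇒antichain : ∀ {k r n} (Qs : Queries k r n) (i : Fin r) (D : Fin n → Bool) →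
                       (∀ {a} → T (D a) → Identifies Qs i a) → Antichain D (trace Qs i)
identifies⇒antichain Qs i _ identifies Da _ ta⊆tb =
  sym (identifies Da _ (λ q a∈Q → T-lookup⇒∈ (∈-tabulate⁻ (ta⊆tb (∈-tabulate⁺ (∈⇒T-lookup a∈Q))))))

solvable⇒≤ : ∀ {k r n} → Solvable k r n → n ≤ r * (k C (k / 2))
solvable⇒≤ {k} {r} {n} (Qs , _ , identified) = begin
  n
    ≡⟨ ∑-fibres player ⟨
  ∑[ i < r ] ∑[ a < n ] χ ⌊ i ≟ player a ⌋
    ≤⟨ ∑-mono-≤ (λ i → sperner _ (trace Qs i) (antichain i)) ⟩
  ∑[ i < r ] (k C (k / 2))
    ≡⟨ ∑-const r _ ⟩
  r * (k C (k / 2))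
    ∎
  where
  player : Fin n → Fin r
  player = proj₁ ∘ identified
  antichain : ∀ i → Antichain (λ a → ⌊ i ≟ player a ⌋) (trace Qs i)
  antichain i = identifies⇒antichain Qs i _
    (λ {a} i≡player → subst (λ j → Identifies Qs j a) (sym (toWitness i≡player))
                             (proj₂ (identified a)))

antichains⇒solvable : ∀ {k r N} (owner : Fin N → Fin r) (label : Fin N → Subset k) →
                      (∀ {x y} → owner x ≡ owner y → label x ⊆ label y → x ≡ y) →
                      (∀ x → ∣ label x ∣ < k) → Solvable k r N
antichains⇒solvable {k} {r} {N} owner label antichain small =
  Qs , disjoint , λ d → owner d , identifies d
  where
  ownedBy : Fin r → Subset N
  ownedBy i = tabulate (λ x → ⌊ owner x ≟ i ⌋)
  avoiding : Fin k → Subset N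
  avoiding q = tabulate (λ x → lookup (∁ (label x)) q)
  Qs : Queries k r N
  Qs q i = ownedBy i ∩ avoiding q

  ∈-Qs⁺ : ∀ {q i x} → owner x ≡ i → q ∉ label x → x ∈ Qs q i
  ∈-Qs⁺ owner≡i q∉label =
    x∈p∩q⁺ (∈-tabulate⁺ (fromWitness owner≡i) , ∈-tabulate⁺ (∈⇒T-lookup (x∉p⇒x∈∁p q∉label)))
  owner-∈-Qs : ∀ {q i x} → x ∈ Qs q i → owner x ≡ i
  owner-∈-Qs {q} {i} x∈Q = toWitness (∈-tabulate⁻ (proj₁ (x∈p∩q⁻ (ownedBy i) (avoiding q) x∈Q)))
  label-∈-Qs : ∀ {q i x} → x ∈ Qs q i → q ∉ label x
  label-∈-Qs {q} {i} x∈Q =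
    x∈∁p⇒x∉p (T-lookup⇒∈ (∈-tabulate⁻ (proj₂ (x∈p∩q⁻ (ownedBy i) (avoiding q) x∈Q))))

  disjoint : ∀ q → PairwiseDisjoint (Qs q)
  disjoint q i j i≢j x x∈Qi x∈Qj = i≢j (trans (sym (owner-∈-Qs x∈Qi)) (owner-∈-Qs x∈Qj))

  identifies : ∀ d → Identifies Qs (owner d) d
  identifies d y sees = antichain owner≡ label⊆
    where
    owner≡ : owner y ≡ owner d
    owner≡ = let q , q∉label = ∣p∣<n⇒∃∉ (label d) (small d) in
      owner-∈-Qs (sees q (∈-Qs⁺ refl q∉label))
    label⊆ : label y ⊆ label d
    label⊆ = ∁p⊆∁q⇒p⊇q (λ q∈∁ → x∉p⇒x∈∁p (label-∈-Qs (sees _ (∈-Qs⁺ refl (x∈∁p⇒x∉p q∈∁)))))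

solvable-central-layers : ∀ {k} r → 1 ≤ k → Solvable k r (r * (k C (k / 2)))
solvable-central-layers {k} r 1≤k = antichains⇒solvable owner label antichain small
  where
  c = k / 2
  owner : Fin (r * (k C c)) → Fin r
  owner = proj₁ ∘ remQuot {r} (k C c)
  label : Fin (r * (k C c)) → Subset k
  label = layer k c ∘ proj₂ ∘ remQuot {r} (k C c)
  antichain : ∀ {x y} → owner x ≡ owner y → label x ⊆ label y → x ≡ y
  antichain owner≡ label⊆ = remQuot-injective {r} (k C c) (cong₂ _,_ owner≡
    (layer-injective k c (p⊆q∧∣p∣≡∣q∣⇒p≡q label⊆ (trans (∣layer∣≡k k c _) (sym (∣layer∣≡k k c _))))))
  small : ∀ x → ∣ label x ∣ < k
  small x = subst (_< k) (sym (∣layer∣≡k k c _)) (m/n<m k 2 {{>-nonZero 1≤k}} (s≤s (s≤s z≤n)))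

theorem3 : ∀ (k r : ℕ) → 1 ≤ k → 1 ≤ r →
    IsG3 k r (r * (k C (k / 2)))
theorem3 _ r 1≤k _ = solvable-central-layers r 1≤k , λ n → solvable⇒≤
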